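{- Let $p,q,a,b$ be complex numbers with $p\neq0$, $q\neq0$, and let $(u_j)$, $(w_j)$ ($j\in\mathbb{Z}$) be as in the context. Then for every positive integer $k$ and all integers $r,s,n,m$: \[ \sum_{j=0}^k (-1)^j q^{(r-s)(k-j)}\binom kj u_{m-s}^j u_{m-r}^{k-j} w_{n-(m-s)k+(r-s)j} = (-1)^k u_{r-s}^k w_n, \] \[ \sum_{j=0}^k q^{(s-r)j}\binom kj u_{r-s}^j u_{m-r}^{k-j} w_{n-(r-s)k+(m-s)j} = q^{(s-r)k} u_{m-s}^k w_n, \] \[ \sum_{j=0}^k (-1)^j\binom kj u_{r-s}^j u_{m-s}^{k-j} w_{n+(r-s)k+(m-r)j} = q^{(r-s)k} u_{m-r}^k w_n, \] \[ \sum_{j=0}^k (-1)^j q^{(r-s)(k-j)}\binom kj u_{m+r}^j u_{m+s}^{k-j} w_{n-(m+r)k+(r-s)j} = (-1)^k u_{r-s}^k w_n, \] \[ \sum_{j=0}^k q^{(s-r)j}\binom kj u_{r-s}^j u_{m+s}^{k-j} w_{n-(r-s)k+(m+r)j} = q^{(s-r)k} u_{m+r}^k w_n, \] \[ \sum_{j=0}^k (-1)^j\binom kj u_{r-s}^j u_{m+r}^{k-j} w_{n+(r-s)k+(m+s)j} = q^{(r-s)k} u_{m+s}^k w_n. \]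
   Context: The Horadam sequence $(w_j)=(w_j(a,b;p,q))$ is defined by $w_0=a$, $w_1=b$, and $w_j=pw_{j-1}-qw_{j-2}$ for all integers $j$ (extended to negative indices via $w_{j-2}=(pw_{j-1}-w_j)/q$). The Lucas sequence of the first kind is $u_j=w_j(0,1;p,q)$, i.e. $u_0=0,u_1=1$ with the same recurrence. Negative powers of $q$ are allowed. -}

module Defs where

open import Level using (Level)
open import Data.Nat using (ℕ; zero; suc)
open import Data.Integer using (ℤ; +_; -[1+_])
open import Algebra.Bundles using (CommutativeRing)

-- Generic constructions over a commutative ring R, with a chosen inverse qi of q.
module Horadam {c ℓ : Level} (R : CommutativeRing c ℓ) where
  open CommutativeRing R

  pow : Carrier → ℕ → Carrier
  pow x zero    = 1#
  pow x (suc n) = x * pow x n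

  -- n-fold sum  n · x  (used for binomial coefficients)
  nmul : ℕ → Carrier → Carrier
  nmul zero    x = 0#
  nmul (suc n) x = x + nmul n x

  sumTo : ℕ → (ℕ → Carrier) → Carrier
  sumTo zero    f = f 0
  sumTo (suc k) f = sumTo k f + f (suc k)

  sgn : ℕ → Carrier
  sgn j = pow (- 1#) j

  zpow : (q qi : Carrier) → ℤ → Carrier
  zpow q qi (+ n)      = pow q n
  zpow q qi -[1+ n ]   = pow qi (suc n)

  wPos : (a b p q : Carrier) → ℕ → Carrier
  wPos a b p q zero          = a
  wPos a b p q (suc zero)    = b
  wPos a b p q (suc (suc n)) = p * wPos a b p q (suc n) - q * wPos a b p q n

  -- w_{-n} for n ≥ 0, via w_{j-2} = (p w_{j-1} - w_j) / q
  wNeg : (a b p q qi : Carrier) → ℕ → Carrier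
  wNeg a b p q qi zero          = a
  wNeg a b p q qi (suc zero)    = (p * a - b) * qi
  wNeg a b p q qi (suc (suc n)) = (p * wNeg a b p q qi (suc n) - wNeg a b p q qi n) * qi

  w : (a b p q qi : Carrier) → ℤ → Carrier
  w a b p q qi (+ n)    = wPos a b p q n
  w a b p q qi -[1+ n ] = wNeg a b p q qi (suc n)

  u : (p q qi : Carrier) → ℤ → Carrier
  u p q qi = w 0# 1# p q qi

module Submission where

-- The six identities are instances of three identities valid for every
-- solution f : ℤ → R of the recurrence f(t+2) = p f(t+1) − q f(t) over an
-- arbitrary commutative ring R in which q has an inverse qi.
--
-- 1. Binomial transfer.  If  α f(t+x) = β f(t+y) + γ f(t)  for all t, then
--    Σ_j C(k,j) β^j γ^(k−j) f(n + jy) = α^k f(n + kx): induction on k,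
--    using Pascal's rule in the form of 'binomialSum-suc'.
-- 2. Index reduction.  For every solution f and integers t, X, Y:
--      U_Y f(t+X) − U_X f(t+Y) = q^X U_(Y−X) f(t).
--    Both sides solve the recurrence in Y − X and agree at two consecutive
--    indices, the second agreement being the Casoratian identity.
-- 3. Each of the three ways of solving the index-reduction identity for one
--    of its three terms is a three-term shift relation; the binomial transfer
--    turns it into one of the identities 'expansion₁/₂/₃'.  The main theorem
--    instantiates these with f = w and two choices of (X, Y) each.

open import Defs
open import Level using (Level)
open import Data.Nat using (ℕ; _≤_)
open import Data.Nat.Combinatorics using (_C_)
open import Data.Integer using (ℤ; +_) renaming (_+_ to _+ℤ_; _-_ to _-ℤ_; _*_ to _*ℤ_)
open import Data.Product using (_×_)
open import Relation.Nullary using (¬_)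
open import Algebra.Bundles using (CommutativeRing)

open import Data.Nat using (zero; suc; _∸_)
import Data.Nat as ℕ
import Data.Nat.Properties as ℕP
import Data.Nat.Combinatorics as ℕC
open import Data.Integer using (-[1+_]) renaming (suc to sucℤ; -_ to -ℤ_)
import Data.Integer as Z
import Data.Integer.Properties as ℤP
open import Data.Integer.Tactic.RingSolver using (solve-∀)
open import Data.Product using (_,_; proj₁)
open import Data.Maybe using (Maybe; just; nothing)
open import Relation.Nullary using (yes; no)
open import Relation.Binary.PropositionalEquality as P using (_≡_)

ℤ-ind : ∀ {a} (Pr : ℤ → Set a) → Pr (+ 0) →
        (∀ i → Pr i → Pr (sucℤ i)) → (∀ i → Pr (sucℤ i) → Pr i) → ∀ i → Pr i
ℤ-ind Pr base up down (+ zero)     = base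
ℤ-ind Pr base up down (+ suc n)    = up (+ n) (ℤ-ind Pr base up down (+ n))
ℤ-ind Pr base up down -[1+ zero ]  = down -[1+ 0 ] base
ℤ-ind Pr base up down -[1+ suc n ] = down -[1+ suc n ] (ℤ-ind Pr base up down -[1+ n ])

module RingFacts {c ℓ : Level} (R : CommutativeRing c ℓ) where
  open CommutativeRing R
  open Horadam R
  open import Relation.Binary.Reasoning.Setoid setoid
  open import Algebra.Properties.Ring ring using (-‿involutive; -0#≈0#; -‿distribˡ-*)
  open import Algebra.Properties.AbelianGroup +-abelianGroup using (⁻¹-∙-comm)
  open import Algebra.Properties.Group +-group using (∙-cancelˡ)
  open import Algebra.Properties.CommutativeSemigroup +-commutativeSemigroup
    using () renaming (x∙yz≈y∙xz to +-leftComm)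

  ι : ℤ → Carrier
  ι (+ n)    = nmul n 1#
  ι -[1+ n ] = - nmul (suc n) 1#

  -- ι is a ring homomorphism: everything follows by two-sided induction
  -- from  ι(i + 1) = 1 + ι(i).
  ι-suc : ∀ i → ι (sucℤ i) ≈ 1# + ι i
  ι-suc (+ n)          = refl
  ι-suc -[1+ zero ]    = begin
    0#               ≈⟨ -‿inverseʳ 1# ⟨
    1# + - 1#        ≈⟨ +-congˡ (-‿cong (+-identityʳ 1#)) ⟨
    1# + - (1# + 0#) ∎
  ι-suc -[1+ suc n ]   = begin
    - nmul (suc n) 1#                   ≈⟨ +-identityˡ _ ⟨
    0# + - nmul (suc n) 1#              ≈⟨ +-congʳ (-‿inverseʳ 1#) ⟨
    (1# + - 1#) + - nmul (suc n) 1#     ≈⟨ +-assoc 1# (- 1#) _ ⟩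
    1# + (- 1# + - nmul (suc n) 1#)     ≈⟨ +-congˡ (⁻¹-∙-comm 1# _) ⟩
    1# + - (1# + nmul (suc n) 1#)       ∎

  ι-+ : ∀ i j → ι (i +ℤ j) ≈ ι i + ι j
  ι-+ = ℤ-ind (λ i → ∀ j → ι (i +ℤ j) ≈ ι i + ι j)
    (λ j → trans (reflexive (P.cong ι (ℤP.+-identityˡ j))) (sym (+-identityˡ (ι j))))
    (λ i ih j → begin
      ι (sucℤ i +ℤ j)     ≈⟨ suc-+ i j ⟩
      ι (sucℤ (i +ℤ j))   ≈⟨ ι-suc (i +ℤ j) ⟩
      1# + ι (i +ℤ j)     ≈⟨ +-congˡ (ih j) ⟩
      1# + (ι i + ι j)    ≈⟨ +-assoc 1# (ι i) (ι j) ⟨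
      (1# + ι i) + ι j    ≈⟨ +-congʳ (ι-suc i) ⟨
      ι (sucℤ i) + ι j    ∎)
    (λ i ih j → ∙-cancelˡ 1# _ _ (begin
      1# + ι (i +ℤ j)     ≈⟨ ι-suc (i +ℤ j) ⟨
      ι (sucℤ (i +ℤ j))   ≈⟨ suc-+ i j ⟨
      ι (sucℤ i +ℤ j)     ≈⟨ ih j ⟩
      ι (sucℤ i) + ι j    ≈⟨ +-congʳ (ι-suc i) ⟩
      (1# + ι i) + ι j    ≈⟨ +-assoc 1# (ι i) (ι j) ⟩
      1# + (ι i + ι j)    ∎))
    where
    suc-+ : ∀ i j → ι (sucℤ i +ℤ j) ≈ ι (sucℤ (i +ℤ j))
    suc-+ i j = reflexive (P.cong ι (ℤP.+-assoc (+ 1) i j))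

  ι-neg : ∀ i → ι (-ℤ i) ≈ - ι i
  ι-neg (+ zero)  = sym -0#≈0#
  ι-neg (+ suc n) = refl
  ι-neg -[1+ n ]  = sym (-‿involutive _)

  ι-* : ∀ i j → ι (i *ℤ j) ≈ ι i * ι j
  ι-* = ℤ-ind (λ i → ∀ j → ι (i *ℤ j) ≈ ι i * ι j)
    (λ j → sym (zeroˡ (ι j)))
    (λ i ih j → begin
      ι (sucℤ i *ℤ j)       ≈⟨ suc-* i j ⟩
      ι j + ι (i *ℤ j)      ≈⟨ +-congˡ (ih j) ⟩
      ι j + ι i * ι j       ≈⟨ step i j ⟩
      ι (sucℤ i) * ι j      ∎)
    (λ i ih j → ∙-cancelˡ (ι j) _ _ (begin
      ι j + ι (i *ℤ j)      ≈⟨ suc-* i j ⟨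
      ι (sucℤ i *ℤ j)       ≈⟨ ih j ⟩
      ι (sucℤ i) * ι j      ≈⟨ step i j ⟨
      ι j + ι i * ι j       ∎))
    where
    suc-* : ∀ i j → ι (sucℤ i *ℤ j) ≈ ι j + ι (i *ℤ j)
    suc-* i j = trans (reflexive (P.cong ι (expand i j))) (ι-+ j (i *ℤ j))
      where
      expand : ∀ i j → (+ 1 +ℤ i) *ℤ j ≡ j +ℤ i *ℤ j
      expand = solve-∀
    step : ∀ i j → ι j + ι i * ι j ≈ ι (sucℤ i) * ι j
    step i j = begin
      ι j + ι i * ι j       ≈⟨ +-congʳ (*-identityˡ (ι j)) ⟨
      1# * ι j + ι i * ι j  ≈⟨ distribʳ (ι j) 1# (ι i) ⟨
      (1# + ι i) * ι j      ≈⟨ *-congʳ (ι-suc i) ⟨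
      ι (sucℤ i) * ι j      ∎

  -- With ι as coefficient map, the generic ring solver works in R.
  import Algebra.Solver.Ring.AlmostCommutativeRing as ACR

  ι-homomorphism : Z.+-*-rawRing ACR.-Raw-AlmostCommutative⟶ ACR.fromCommutativeRing R
  ι-homomorphism = record
    { ⟦_⟧ = ι ; +-homo = ι-+ ; *-homo = ι-* ; -‿homo = ι-neg
    ; 0-homo = refl ; 1-homo = +-identityʳ 1# }

  ι-equal? : ∀ i j → Maybe (ι i ≈ ι j)
  ι-equal? i j with i ℤP.≟ j
  ... | yes P.refl = just refl
  ... | no _       = nothing

  open import Algebra.Solver.Ring Z.+-*-rawRing (ACR.fromCommutativeRing R) ι-homomorphism ι-equal?
    public

  pow-cong : ∀ {x y} → x ≈ y → ∀ n → pow x n ≈ pow y n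
  pow-cong x≈y zero    = refl
  pow-cong x≈y (suc n) = *-cong x≈y (pow-cong x≈y n)

  pow-distrib : ∀ x y n → pow (x * y) n ≈ pow x n * pow y n
  pow-distrib x y zero    = sym (*-identityˡ 1#)
  pow-distrib x y (suc n) = trans (*-congˡ (pow-distrib x y n))
    (solve 4 (λ x y a b → (x :* y) :* (a :* b) := (x :* a) :* (y :* b)) refl x y (pow x n) (pow y n))

  pow-neg : ∀ x n → pow (- x) n ≈ sgn n * pow x n
  pow-neg x n = trans (pow-cong -x≈-1*x n) (pow-distrib (- 1#) x n)
    where
    -x≈-1*x : - x ≈ - 1# * x
    -x≈-1*x = trans (-‿cong (sym (*-identityˡ x))) (-‿distribˡ-* 1# x)

  -- n-fold sums are additive in n; this turns Pascal's rule into R.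
  nmul-+ : ∀ m n x → nmul (m ℕ.+ n) x ≈ nmul m x + nmul n x
  nmul-+ zero    n x = sym (+-identityˡ _)
  nmul-+ (suc m) n x = trans (+-congˡ (nmul-+ m n x)) (sym (+-assoc _ _ _))

  sumTo-cong≤ : ∀ k {f g} → (∀ j → j ≤ k → f j ≈ g j) → sumTo k f ≈ sumTo k g
  sumTo-cong≤ zero    f≈g = f≈g 0 ℕ.z≤n
  sumTo-cong≤ (suc k) f≈g =
    +-cong (sumTo-cong≤ k (λ j j≤k → f≈g j (ℕP.m≤n⇒m≤1+n j≤k))) (f≈g (suc k) ℕP.≤-refl)

  sumTo-cong : ∀ k {f g} → (∀ j → f j ≈ g j) → sumTo k f ≈ sumTo k g
  sumTo-cong k f≈g = sumTo-cong≤ k (λ j _ → f≈g j)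

  sumTo-+ : ∀ k f g → sumTo k (λ j → f j + g j) ≈ sumTo k f + sumTo k g
  sumTo-+ zero    f g = refl
  sumTo-+ (suc k) f g = trans (+-congʳ (sumTo-+ k f g))
    (solve 4 (λ a b c d → (a :+ b) :+ (c :+ d) := (a :+ c) :+ (b :+ d)) refl _ _ _ _)

  sumTo-*ˡ : ∀ k x f → x * sumTo k f ≈ sumTo k (λ j → x * f j)
  sumTo-*ˡ zero    x f = refl
  sumTo-*ˡ (suc k) x f = trans (distribˡ x _ _) (+-congʳ (sumTo-*ˡ k x f))

  sumTo-unfoldˡ : ∀ k f → sumTo (suc k) f ≈ f 0 + sumTo k (λ j → f (suc j))
  sumTo-unfoldˡ zero    f = refl
  sumTo-unfoldˡ (suc k) f = trans (+-congʳ (sumTo-unfoldˡ k f)) (+-assoc _ _ _)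

  sumTo-dropLast : ∀ k f → f (suc k) ≈ 0# → sumTo (suc k) f ≈ sumTo k f
  sumTo-dropLast k f last≈0 = trans (+-congˡ last≈0) (+-identityʳ _)

  binomialSum : Carrier → Carrier → (ℕ → Carrier) → ℕ → Carrier
  binomialSum β γ F k = sumTo k (λ j → nmul (k C j) 1# * pow β j * pow γ (k ∸ j) * F j)

  binomialSum-cong : ∀ β γ k {F G} → (∀ j → F j ≈ G j) →
                     binomialSum β γ F k ≈ binomialSum β γ G k
  binomialSum-cong β γ k F≈G = sumTo-cong k (λ j → *-congˡ (F≈G j))

  binomialSum-scale : ∀ α β γ F k →
                      binomialSum β γ (λ j → α * F j) k ≈ α * binomialSum β γ F k
  binomialSum-scale α β γ F k = sym (trans (sumTo-*ˡ k α _)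
    (sumTo-cong k (λ j → solve 5 (λ α c b g f → α :* (c :* b :* g :* f) := c :* b :* g :* (α :* f))
                                  refl α _ _ _ _)))

  -- Pascal's rule for binomial sums: k + 1 binomial steps on F are k steps
  -- on the sequence j ↦ β F(j+1) + γ F(j).
  binomialSum-suc : ∀ β γ F k →
    binomialSum β γ F (suc k) ≈ binomialSum β γ (λ j → β * F (suc j) + γ * F j) k
  binomialSum-suc β γ F k = begin
    binomialSum β γ F (suc k)
      ≈⟨ sumTo-unfoldˡ k (term (suc k)) ⟩
    stay 0 + sumTo k (λ j → term (suc k) (suc j))
      ≈⟨ +-congˡ (sumTo-cong k pascal) ⟩
    stay 0 + sumTo k (λ j → raise j + stay (suc j))
      ≈⟨ +-congˡ (sumTo-+ k raise (λ j → stay (suc j))) ⟩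
    stay 0 + (sumTo k raise + sumTo k (λ j → stay (suc j)))
      ≈⟨ +-leftComm _ _ _ ⟩
    sumTo k raise + (stay 0 + sumTo k (λ j → stay (suc j)))
      ≈⟨ +-congˡ (sumTo-unfoldˡ k stay) ⟨
    sumTo k raise + sumTo (suc k) stay
      ≈⟨ +-congˡ (sumTo-dropLast k stay last-stay≈0) ⟩
    sumTo k raise + sumTo k stay
      ≈⟨ sumTo-+ k raise stay ⟨
    sumTo k (λ j → raise j + stay j)
      ≈⟨ sumTo-cong≤ k split ⟨
    binomialSum β γ (λ j → β * F (suc j) + γ * F j) k ∎
    where
    coeff : ℕ → Carrier
    coeff j = nmul (k C j) 1#
    term : ℕ → ℕ → Carrier
    term n j = nmul (n C j) 1# * pow β j * pow γ (n ∸ j) * F j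
    -- the two halves of  coeff j · β^j γ^(k−j) (β F(j+1) + γ F(j))
    raise stay : ℕ → Carrier
    raise j = coeff j * pow β (suc j) * pow γ (k ∸ j) * F (suc j)
    stay  j = coeff j * pow β j * pow γ (suc k ∸ j) * F j

    split : ∀ j → j ≤ k →
            coeff j * pow β j * pow γ (k ∸ j) * (β * F (suc j) + γ * F j) ≈ raise j + stay j
    split j j≤k = begin
      coeff j * pow β j * pow γ (k ∸ j) * (β * F (suc j) + γ * F j)
        ≈⟨ solve 7 (λ a b g β γ F₁ F₀ → a :* b :* g :* (β :* F₁ :+ γ :* F₀)
                                       := a :* (β :* b) :* g :* F₁ :+ a :* b :* (γ :* g) :* F₀)
                   refl (coeff j) (pow β j) (pow γ (k ∸ j)) β γ (F (suc j)) (F j) ⟩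
      raise j + coeff j * pow β j * pow γ (suc (k ∸ j)) * F j
        ≈⟨ +-congˡ (reflexive (P.cong (λ e → coeff j * pow β j * pow γ e * F j)
                                       (P.sym (ℕP.+-∸-assoc 1 j≤k)))) ⟩
      raise j + stay j ∎

    pascal : ∀ j → term (suc k) (suc j) ≈ raise j + stay (suc j)
    pascal j = begin
      nmul (suc k C suc j) 1# * βʲ⁺¹ * γᵏ⁻ʲ * Fʲ⁺¹
        ≈⟨ *-congʳ (*-congʳ (*-congʳ (reflexive (P.cong (λ n → nmul n 1#)
                                       (P.sym (ℕC.nCk+nC[k+1]≡[n+1]C[k+1] k j)))))) ⟩
      nmul (k C j ℕ.+ k C suc j) 1# * βʲ⁺¹ * γᵏ⁻ʲ * Fʲ⁺¹
        ≈⟨ *-congʳ (*-congʳ (*-congʳ (nmul-+ (k C j) (k C suc j) 1#))) ⟩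
      (coeff j + coeff (suc j)) * βʲ⁺¹ * γᵏ⁻ʲ * Fʲ⁺¹
        ≈⟨ solve 5 (λ a a′ b g f → (a :+ a′) :* b :* g :* f := a :* b :* g :* f :+ a′ :* b :* g :* f)
                   refl _ _ _ _ _ ⟩
      raise j + stay (suc j) ∎
      where
      βʲ⁺¹ γᵏ⁻ʲ Fʲ⁺¹ : Carrier
      βʲ⁺¹ = pow β (suc j)
      γᵏ⁻ʲ = pow γ (k ∸ j)
      Fʲ⁺¹ = F (suc j)

    last-stay≈0 : stay (suc k) ≈ 0#
    last-stay≈0 = begin
      coeff (suc k) * pow β (suc k) * pow γ (k ∸ k) * F (suc k)
        ≈⟨ *-congʳ (*-congʳ (*-congʳ (reflexive (P.cong (λ n → nmul n 1#)
                                        (ℕC.k>n⇒nCk≡0 (ℕP.n<1+n k)))))) ⟩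
      0# * pow β (suc k) * pow γ (k ∸ k) * F (suc k)
        ≈⟨ *-congʳ (*-congʳ (zeroˡ _)) ⟩
      0# * pow γ (k ∸ k) * F (suc k)  ≈⟨ *-congʳ (zeroˡ _) ⟩
      0# * F (suc k)            ≈⟨ zeroˡ _ ⟩
      0# ∎

  binomialTransfer : (f : ℤ → Carrier) (α β γ : Carrier) (x y : ℤ) →
    (∀ t → α * f (t +ℤ x) ≈ β * f (t +ℤ y) + γ * f t) →
    ∀ k n → binomialSum β γ (λ j → f (n +ℤ y *ℤ + j)) k ≈ pow α k * f (n +ℤ x *ℤ + k)
  binomialTransfer f α β γ x y shift zero n = begin
    (1# + 0#) * 1# * 1# * f (n +ℤ y *ℤ + 0)
      ≈⟨ *-congʳ (trans (*-identityʳ _) (trans (*-identityʳ _) (+-identityʳ _))) ⟩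
    1# * f (n +ℤ y *ℤ + 0)
      ≈⟨ *-congˡ (reflexive (P.cong f (P.trans (times0 n y) (P.sym (times0 n x))))) ⟩
    1# * f (n +ℤ x *ℤ + 0) ∎
    where
    times0 : ∀ n y → n +ℤ y *ℤ + 0 ≡ n
    times0 = solve-∀
  binomialTransfer f α β γ x y shift (suc k) n = begin
    binomialSum β γ (λ j → f (n +ℤ y *ℤ + j)) (suc k)
      ≈⟨ binomialSum-suc β γ _ k ⟩
    binomialSum β γ (λ j → β * f (n +ℤ y *ℤ + suc j) + γ * f (n +ℤ y *ℤ + j)) k
      ≈⟨ binomialSum-cong β γ k apply-shift ⟨
    binomialSum β γ (λ j → α * f ((n +ℤ x) +ℤ y *ℤ + j)) k
      ≈⟨ binomialSum-scale α β γ _ k ⟩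
    α * binomialSum β γ (λ j → f ((n +ℤ x) +ℤ y *ℤ + j)) k
      ≈⟨ *-congˡ (binomialTransfer f α β γ x y shift k (n +ℤ x)) ⟩
    α * (pow α k * f ((n +ℤ x) +ℤ x *ℤ + k))
      ≈⟨ *-assoc α (pow α k) _ ⟨
    pow α (suc k) * f ((n +ℤ x) +ℤ x *ℤ + k)
      ≈⟨ *-congˡ (reflexive (P.cong f (P.sym (regroup n x (+ k))))) ⟩
    pow α (suc k) * f (n +ℤ x *ℤ + suc k) ∎
    where
    regroup : ∀ n x K → n +ℤ x *ℤ (+ 1 +ℤ K) ≡ (n +ℤ x) +ℤ x *ℤ K
    regroup = solve-∀
    swap : ∀ n x y J → (n +ℤ y *ℤ J) +ℤ x ≡ (n +ℤ x) +ℤ y *ℤ J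
    swap = solve-∀
    advance : ∀ n y J → (n +ℤ y *ℤ J) +ℤ y ≡ n +ℤ y *ℤ (+ 1 +ℤ J)
    advance = solve-∀
    apply-shift : ∀ j → α * f ((n +ℤ x) +ℤ y *ℤ + j)
                        ≈ β * f (n +ℤ y *ℤ + suc j) + γ * f (n +ℤ y *ℤ + j)
    apply-shift j = begin
      α * f ((n +ℤ x) +ℤ y *ℤ + j)            ≈⟨ *-congˡ (reflexive (P.cong f (P.sym (swap n x y (+ j))))) ⟩
      α * f (t +ℤ x)                          ≈⟨ shift t ⟩
      β * f (t +ℤ y) + γ * f t                ≈⟨ +-congʳ (*-congˡ (reflexive (P.cong f (advance n y (+ j))))) ⟩
      β * f (n +ℤ y *ℤ + suc j) + γ * f t     ∎
      where
      t : ℤ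
      t = n +ℤ y *ℤ + j

  module Recurrence (p q qi : Carrier) (q*qi≈1 : q * qi ≈ 1#) where
    U : ℤ → Carrier
    U = u p q qi
    Q : ℤ → Carrier
    Q = zpow q qi

    q*[qi*x]≈x : ∀ x → q * (qi * x) ≈ x
    q*[qi*x]≈x x = trans (sym (*-assoc q qi x)) (trans (*-congʳ q*qi≈1) (*-identityˡ x))

    q*[x*qi]≈x : ∀ x → q * (x * qi) ≈ x
    q*[x*qi]≈x x = trans (*-congˡ (*-comm x qi)) (q*[qi*x]≈x x)

    q-cancel : ∀ {x y} → q * x ≈ q * y → x ≈ y
    q-cancel {x} {y} qx≈qy = begin
      x             ≈⟨ qi*[q*x]≈x x ⟨
      qi * (q * x)  ≈⟨ *-congˡ qx≈qy ⟩
      qi * (q * y)  ≈⟨ qi*[q*x]≈x y ⟩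
      y             ∎
      where
      qi*[q*x]≈x : ∀ z → qi * (q * z) ≈ z
      qi*[q*x]≈x z = trans (solve 3 (λ q z i → i :* (q :* z) := q :* (i :* z)) refl q z qi)
                           (q*[qi*x]≈x z)

    IsSolution : (ℤ → Carrier) → Set ℓ
    IsSolution f = ∀ t → f (sucℤ (sucℤ t)) ≈ p * f (sucℤ t) - q * f t

    -- the backward step  w_{j−2} = (p w_{j−1} − w_j) qi  inverts the recurrence
    undo-step : ∀ x y → p * x - q * ((p * x - y) * qi) ≈ y
    undo-step x y = begin
      p * x - q * ((p * x - y) * qi)  ≈⟨ +-congˡ (-‿cong (q*[x*qi]≈x _)) ⟩
      p * x - (p * x - y)             ≈⟨ solve 2 (λ a y → a :- (a :- y) := y) refl (p * x) y ⟩
      y                               ∎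

    w-isSolution : ∀ a b → IsSolution (w a b p q qi)
    w-isSolution a b (+ n)               = refl
    w-isSolution a b -[1+ zero ]         = sym (undo-step a b)
    w-isSolution a b -[1+ suc zero ]     = sym (undo-step (wNeg a b p q qi 1) a)
    w-isSolution a b -[1+ suc (suc n) ]  =
      sym (undo-step (wNeg a b p q qi (suc (suc n))) (wNeg a b p q qi (suc n)))

    U-isSolution : IsSolution U
    U-isSolution = w-isSolution 0# 1#

    solution-shift : ∀ {f} → IsSolution f → ∀ t → IsSolution (λ i → f (t +ℤ i))
    solution-shift {f} sol t i = begin
      f (t +ℤ sucℤ (sucℤ i))              ≈⟨ reflexive (P.cong f (P.trans (commute t (sucℤ i))
                                                                          (P.cong sucℤ (commute t i)))) ⟩
      f (sucℤ (sucℤ (t +ℤ i)))            ≈⟨ sol (t +ℤ i) ⟩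
      p * f (sucℤ (t +ℤ i)) - q * f (t +ℤ i) ≈⟨ +-congʳ (*-congˡ (reflexive (P.cong f (P.sym (commute t i))))) ⟩
      p * f (t +ℤ sucℤ i) - q * f (t +ℤ i) ∎
      where
      commute : ∀ t i → t +ℤ (+ 1 +ℤ i) ≡ + 1 +ℤ (t +ℤ i)
      commute = solve-∀

    solution-combination : ∀ {f g} α β → IsSolution f → IsSolution g →
                           IsSolution (λ t → α * f t - β * g t)
    solution-combination {f} {g} α β solf solg t = begin
      α * f (sucℤ (sucℤ t)) - β * g (sucℤ (sucℤ t))
        ≈⟨ +-cong (*-congˡ (solf t)) (-‿cong (*-congˡ (solg t))) ⟩
      α * (p * f (sucℤ t) - q * f t) - β * (p * g (sucℤ t) - q * g t)
        ≈⟨ solve 8 (λ α β p q f₁ f₀ g₁ g₀ →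
                      α :* (p :* f₁ :- q :* f₀) :- β :* (p :* g₁ :- q :* g₀)
                   := p :* (α :* f₁ :- β :* g₁) :- q :* (α :* f₀ :- β :* g₀))
                   refl α β p q (f (sucℤ t)) (f t) (g (sucℤ t)) (g t) ⟩
      p * (α * f (sucℤ t) - β * g (sucℤ t)) - q * (α * f t - β * g t) ∎

    solution-scale : ∀ {f} α → IsSolution f → IsSolution (λ t → α * f t)
    solution-scale {f} α sol t = trans (*-congˡ (sol t))
      (solve 5 (λ α p q f₁ f₀ → α :* (p :* f₁ :- q :* f₀) := p :* (α :* f₁) :- q :* (α :* f₀))
             refl α p q (f (sucℤ t)) (f t))

    -- A solution is determined by two consecutive values; going downwards
    -- uses that q is invertible.
    solution-unique : ∀ {f g} → IsSolution f → IsSolution g →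
                      f (+ 0) ≈ g (+ 0) → f (+ 1) ≈ g (+ 1) → ∀ t → f t ≈ g t
    solution-unique {f} {g} solf solg eq₀ eq₁ t = proj₁ (ℤ-ind Agree (eq₀ , eq₁) up down t)
      where
      Agree : ℤ → Set ℓ
      Agree t = f t ≈ g t × f (sucℤ t) ≈ g (sucℤ t)
      backward : ∀ {h} → IsSolution h → ∀ t → q * h t ≈ p * h (sucℤ t) - h (sucℤ (sucℤ t))
      backward {h} sol t = trans
        (solve 3 (λ p a b → b := p :* a :- (p :* a :- b)) refl p (h (sucℤ t)) (q * h t))
        (+-congˡ (-‿cong (sym (sol t))))
      up : ∀ t → Agree t → Agree (sucℤ t)
      up t (e₀ , e₁) = e₁ , trans (solf t)
        (trans (+-cong (*-congˡ e₁) (-‿cong (*-congˡ e₀))) (sym (solg t)))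
      down : ∀ t → Agree (sucℤ t) → Agree t
      down t (e₁ , e₂) = q-cancel (trans (backward solf t)
        (trans (+-cong (*-congˡ e₁) (-‿cong e₂)) (sym (backward solg t)))) , e₁

    Q-suc : ∀ x → Q (sucℤ x) ≈ q * Q x
    Q-suc (+ n)          = refl
    Q-suc -[1+ zero ]    = sym (q*[qi*x]≈x 1#)
    Q-suc -[1+ suc n ]   = sym (q*[qi*x]≈x (pow qi (suc n)))

    geometric : ∀ (D : ℤ → Carrier) → (∀ x → D (sucℤ x) ≈ q * D x) → ∀ x → D x ≈ Q x * D (+ 0)
    geometric D step = ℤ-ind (λ x → D x ≈ Q x * D (+ 0)) (sym (*-identityˡ _))
      (λ x ih → begin
        D (sucℤ x)            ≈⟨ step x ⟩
        q * D x               ≈⟨ *-congˡ ih ⟩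
        q * (Q x * D (+ 0))   ≈⟨ *-assoc _ _ _ ⟨
        (q * Q x) * D (+ 0)   ≈⟨ *-congʳ (Q-suc x) ⟨
        Q (sucℤ x) * D (+ 0)  ∎)
      (λ x ih → q-cancel (begin
        q * D x               ≈⟨ step x ⟨
        D (sucℤ x)            ≈⟨ ih ⟩
        Q (sucℤ x) * D (+ 0)  ≈⟨ *-congʳ (Q-suc x) ⟩
        (q * Q x) * D (+ 0)   ≈⟨ *-assoc _ _ _ ⟩
        q * (Q x * D (+ 0))   ∎))

    Q-+ : ∀ i j → Q (i +ℤ j) ≈ Q i * Q j
    Q-+ i j = trans
      (geometric (λ i → Q (i +ℤ j))
                 (λ i → trans (reflexive (P.cong Q (ℤP.+-assoc (+ 1) i j))) (Q-suc (i +ℤ j))) i)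
      (*-congˡ (reflexive (P.cong Q (ℤP.+-identityˡ j))))

    Q-* : ∀ x t → Q (x *ℤ + t) ≈ pow (Q x) t
    Q-* x zero    = reflexive (P.cong Q (ℤP.*-zeroʳ x))
    Q-* x (suc t) = trans (reflexive (P.cong Q (unfold x (+ t))))
                          (trans (Q-+ x (x *ℤ + t)) (*-congˡ (Q-* x t)))
      where
      unfold : ∀ x T → x *ℤ (+ 1 +ℤ T) ≡ x +ℤ x *ℤ T
      unfold = solve-∀

    Q-inverse : ∀ x x′ → x′ +ℤ x ≡ + 0 → Q x′ * Q x ≈ 1#
    Q-inverse x x′ x′+x≡0 = trans (sym (Q-+ x′ x)) (reflexive (P.cong Q x′+x≡0))

    casoratian : ∀ {f} → IsSolution f → ∀ x → U (sucℤ x) * f x - U x * f (sucℤ x) ≈ Q x * f (+ 0)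
    casoratian {f} sol x = trans (geometric D step x) (*-congˡ D₀)
      where
      D : ℤ → Carrier
      D x = U (sucℤ x) * f x - U x * f (sucℤ x)
      step : ∀ x → D (sucℤ x) ≈ q * D x
      step x = begin
        U (sucℤ (sucℤ x)) * f (sucℤ x) - U (sucℤ x) * f (sucℤ (sucℤ x))
          ≈⟨ +-cong (*-congʳ (U-isSolution x)) (-‿cong (*-congˡ (sol x))) ⟩
        (p * U (sucℤ x) - q * U x) * f (sucℤ x) - U (sucℤ x) * (p * f (sucℤ x) - q * f x)
          ≈⟨ solve 6 (λ p q u₁ u₀ f₁ f₀ → (p :* u₁ :- q :* u₀) :* f₁ :- u₁ :* (p :* f₁ :- q :* f₀)
                                       := q :* (u₁ :* f₀ :- u₀ :* f₁))
                     refl p q (U (sucℤ x)) (U x) (f (sucℤ x)) (f x) ⟩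
        q * D x ∎
      D₀ : D (+ 0) ≈ f (+ 0)
      D₀ = begin
        1# * f (+ 0) - 0# * f (+ 1)  ≈⟨ +-cong (*-identityˡ _) (-‿cong (zeroˡ _)) ⟩
        f (+ 0) - 0#                 ≈⟨ +-congˡ -0#≈0# ⟩
        f (+ 0) + 0#                 ≈⟨ +-identityʳ _ ⟩
        f (+ 0)                      ∎

    -- Index reduction at t = 0: both sides, as functions of Y − X, solve the
    -- recurrence and agree at 0 (trivially) and at 1 (Casoratian).
    index-reduction₀ : ∀ {f} → IsSolution f → ∀ X Y →
                       U Y * f X - U X * f Y ≈ Q X * U (Y -ℤ X) * f (+ 0)
    index-reduction₀ {f} sol X Y = begin
      U Y * f X - U X * f Y
        ≈⟨ +-congʳ (*-comm _ _) ⟩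
      f X * U Y - U X * f Y
        ≈⟨ reflexive (P.cong (λ i → f X * U i - U X * f i) (P.sym (cancel X Y))) ⟩
      G (Y -ℤ X)
        ≈⟨ solution-unique (solution-combination (f X) (U X) (solution-shift U-isSolution X)
                                                             (solution-shift sol X))
                           (solution-scale κ U-isSolution) G₀ G₁ (Y -ℤ X) ⟩
      κ * U (Y -ℤ X)
        ≈⟨ solve 3 (λ a b d → (a :* b) :* d := a :* d :* b) refl _ _ _ ⟩
      Q X * U (Y -ℤ X) * f (+ 0) ∎
      where
      cancel : ∀ X Y → X +ℤ (Y -ℤ X) ≡ Y
      cancel = solve-∀
      κ : Carrier
      κ = Q X * f (+ 0)
      G : ℤ → Carrier
      G t = f X * U (X +ℤ t) - U X * f (X +ℤ t)
      G₀ : G (+ 0) ≈ κ * U (+ 0)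
      G₀ = begin
        G (+ 0)                ≈⟨ reflexive (P.cong (λ i → f X * U i - U X * f i) (ℤP.+-identityʳ X)) ⟩
        f X * U X - U X * f X  ≈⟨ solve 2 (λ a b → a :* b :- b :* a := con (+ 0)) refl (f X) (U X) ⟩
        0#                     ≈⟨ zeroʳ κ ⟨
        κ * 0#                 ∎
      G₁ : G (+ 1) ≈ κ * U (+ 1)
      G₁ = begin
        G (+ 1)                                    ≈⟨ reflexive (P.cong (λ i → f X * U i - U X * f i)
                                                                        (ℤP.+-comm X (+ 1))) ⟩
        f X * U (sucℤ X) - U X * f (sucℤ X)        ≈⟨ +-congʳ (*-comm _ _) ⟩
        U (sucℤ X) * f X - U X * f (sucℤ X)        ≈⟨ casoratian sol X ⟩
        κ                                          ≈⟨ *-identityʳ κ ⟨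
        κ * 1#                                     ∎

    index-reduction : ∀ {f} → IsSolution f → ∀ t X Y →
                      U Y * f (t +ℤ X) - U X * f (t +ℤ Y) ≈ Q X * U (Y -ℤ X) * f t
    index-reduction {f} sol t X Y =
      trans (index-reduction₀ (solution-shift sol t) X Y)
            (*-congˡ (reflexive (P.cong f (ℤP.+-identityʳ t))))

    -- Solving the index reduction for f(t+Y) and transferring.
    expansion₁ : ∀ {f} → IsSolution f → ∀ k (X Y Z n : ℤ) → Z ≡ Y -ℤ X →
      sumTo k (λ j → sgn j * Q (X *ℤ + (k ∸ j)) * nmul (k C j) 1#
                     * pow (U Y) j * pow (U Z) (k ∸ j) * f (n -ℤ Y *ℤ + k +ℤ X *ℤ + j))
      ≈ sgn k * pow (U X) k * f n
    expansion₁ {f} sol k X Y .(Y -ℤ X) n P.refl = begin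
      sumTo k _
        ≈⟨ sumTo-cong k summand ⟩
      binomialSum (- U Y) (Q X * U (Y -ℤ X)) (λ j → f (n′ +ℤ X *ℤ + j)) k
        ≈⟨ binomialTransfer f (- U X) (- U Y) (Q X * U (Y -ℤ X)) Y X shift k n′ ⟩
      pow (- U X) k * f (n′ +ℤ Y *ℤ + k)
        ≈⟨ *-cong (pow-neg _ k) (reflexive (P.cong f (restore n Y (+ k)))) ⟩
      sgn k * pow (U X) k * f n ∎
      where
      restore : ∀ n Y K → n -ℤ Y *ℤ K +ℤ Y *ℤ K ≡ n
      restore = solve-∀
      n′ : ℤ
      n′ = n -ℤ Y *ℤ + k
      shift : ∀ t → (- U X) * f (t +ℤ Y) ≈ (- U Y) * f (t +ℤ X) + (Q X * U (Y -ℤ X)) * f t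
      shift t = begin
        (- U X) * f (t +ℤ Y)
          ≈⟨ solve 4 (λ uy fx ux fy → (:- ux) :* fy := (:- uy) :* fx :+ (uy :* fx :- ux :* fy))
                     refl (U Y) (f (t +ℤ X)) (U X) (f (t +ℤ Y)) ⟩
        (- U Y) * f (t +ℤ X) + (U Y * f (t +ℤ X) - U X * f (t +ℤ Y))
          ≈⟨ +-congˡ (index-reduction sol t X Y) ⟩
        (- U Y) * f (t +ℤ X) + (Q X * U (Y -ℤ X)) * f t ∎
      summand : ∀ j → sgn j * Q (X *ℤ + (k ∸ j)) * nmul (k C j) 1# * pow (U Y) j
                      * pow (U (Y -ℤ X)) (k ∸ j) * f (n′ +ℤ X *ℤ + j)
                    ≈ nmul (k C j) 1# * pow (- U Y) j * pow (Q X * U (Y -ℤ X)) (k ∸ j)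
                      * f (n′ +ℤ X *ℤ + j)
      summand j = begin
        sgn j * Q (X *ℤ + (k ∸ j)) * cf * pow (U Y) j * pow (U (Y -ℤ X)) (k ∸ j) * fj
          ≈⟨ *-congʳ (*-congʳ (*-congʳ (*-congʳ (*-congˡ (Q-* X (k ∸ j)))))) ⟩
        sgn j * pow (Q X) (k ∸ j) * cf * pow (U Y) j * pow (U (Y -ℤ X)) (k ∸ j) * fj
          ≈⟨ solve 6 (λ s z c a b w → s :* z :* c :* a :* b :* w := c :* (s :* a) :* (z :* b) :* w)
                     refl (sgn j) (pow (Q X) (k ∸ j)) cf (pow (U Y) j) (pow (U (Y -ℤ X)) (k ∸ j)) fj ⟩
        cf * (sgn j * pow (U Y) j) * (pow (Q X) (k ∸ j) * pow (U (Y -ℤ X)) (k ∸ j)) * fj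
          ≈⟨ *-congʳ (*-cong (*-congˡ (sym (pow-neg _ j))) (sym (pow-distrib _ _ (k ∸ j)))) ⟩
        cf * pow (- U Y) j * pow (Q X * U (Y -ℤ X)) (k ∸ j) * fj ∎
        where
        cf fj : Carrier
        cf = nmul (k C j) 1#
        fj = f (n′ +ℤ X *ℤ + j)

    -- Solving the index reduction for f(t+X) and transferring; x′ = −X.
    expansion₂ : ∀ {f} → IsSolution f → ∀ k (X x′ Y Z n : ℤ) → x′ +ℤ X ≡ + 0 → Z ≡ Y -ℤ X →
      sumTo k (λ j → Q (x′ *ℤ + j) * nmul (k C j) 1#
                     * pow (U X) j * pow (U Z) (k ∸ j) * f (n -ℤ X *ℤ + k +ℤ Y *ℤ + j))
      ≈ Q (x′ *ℤ + k) * pow (U Y) k * f n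
    expansion₂ {f} sol k X x′ Y .(Y -ℤ X) n x′+X≡0 P.refl = begin
      sumTo k _
        ≈⟨ sumTo-cong k summand ⟩
      binomialSum (Q x′ * U X) (U (Y -ℤ X)) (λ j → f (n′ +ℤ Y *ℤ + j)) k
        ≈⟨ binomialTransfer f (Q x′ * U Y) (Q x′ * U X) (U (Y -ℤ X)) X Y shift k n′ ⟩
      pow (Q x′ * U Y) k * f (n′ +ℤ X *ℤ + k)
        ≈⟨ *-cong (trans (pow-distrib _ _ k) (*-congʳ (sym (Q-* x′ k))))
                  (reflexive (P.cong f (restore n X (+ k)))) ⟩
      Q (x′ *ℤ + k) * pow (U Y) k * f n ∎
      where
      restore : ∀ n X K → n -ℤ X *ℤ K +ℤ X *ℤ K ≡ n
      restore = solve-∀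
      n′ : ℤ
      n′ = n -ℤ X *ℤ + k
      shift : ∀ t → (Q x′ * U Y) * f (t +ℤ X) ≈ (Q x′ * U X) * f (t +ℤ Y) + U (Y -ℤ X) * f t
      shift t = begin
        (Q x′ * U Y) * f (t +ℤ X)
          ≈⟨ solve 5 (λ e uy fx ux fy → (e :* uy) :* fx := (e :* ux) :* fy :+ e :* (uy :* fx :- ux :* fy))
                     refl (Q x′) (U Y) (f (t +ℤ X)) (U X) (f (t +ℤ Y)) ⟩
        (Q x′ * U X) * f (t +ℤ Y) + Q x′ * (U Y * f (t +ℤ X) - U X * f (t +ℤ Y))
          ≈⟨ +-congˡ (*-congˡ (index-reduction sol t X Y)) ⟩
        (Q x′ * U X) * f (t +ℤ Y) + Q x′ * (Q X * U (Y -ℤ X) * f t)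
          ≈⟨ +-congˡ (solve 4 (λ e i a b → e :* (i :* a :* b) := (e :* i) :* (a :* b))
                              refl (Q x′) (Q X) (U (Y -ℤ X)) (f t)) ⟩
        (Q x′ * U X) * f (t +ℤ Y) + (Q x′ * Q X) * (U (Y -ℤ X) * f t)
          ≈⟨ +-congˡ (trans (*-congʳ (Q-inverse X x′ x′+X≡0)) (*-identityˡ _)) ⟩
        (Q x′ * U X) * f (t +ℤ Y) + U (Y -ℤ X) * f t ∎
      summand : ∀ j → Q (x′ *ℤ + j) * nmul (k C j) 1# * pow (U X) j * pow (U (Y -ℤ X)) (k ∸ j)
                      * f (n′ +ℤ Y *ℤ + j)
                    ≈ nmul (k C j) 1# * pow (Q x′ * U X) j * pow (U (Y -ℤ X)) (k ∸ j)
                      * f (n′ +ℤ Y *ℤ + j)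
      summand j = begin
        Q (x′ *ℤ + j) * cf * pow (U X) j * pow (U (Y -ℤ X)) (k ∸ j) * fj
          ≈⟨ *-congʳ (*-congʳ (*-congʳ (*-congʳ (Q-* x′ j)))) ⟩
        pow (Q x′) j * cf * pow (U X) j * pow (U (Y -ℤ X)) (k ∸ j) * fj
          ≈⟨ solve 5 (λ z c a b w → z :* c :* a :* b :* w := c :* (z :* a) :* b :* w)
                     refl (pow (Q x′) j) cf (pow (U X) j) (pow (U (Y -ℤ X)) (k ∸ j)) fj ⟩
        cf * (pow (Q x′) j * pow (U X) j) * pow (U (Y -ℤ X)) (k ∸ j) * fj
          ≈⟨ *-congʳ (*-congʳ (*-congˡ (sym (pow-distrib _ _ j)))) ⟩
        cf * pow (Q x′ * U X) j * pow (U (Y -ℤ X)) (k ∸ j) * fj ∎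
        where
        cf fj : Carrier
        cf = nmul (k C j) 1#
        fj = f (n′ +ℤ Y *ℤ + j)

    -- Solving the index reduction for f(t) and transferring.
    expansion₃ : ∀ {f} → IsSolution f → ∀ k (X Y V n : ℤ) → V ≡ Y -ℤ X →
      sumTo k (λ j → sgn j * nmul (k C j) 1#
                     * pow (U X) j * pow (U Y) (k ∸ j) * f (n +ℤ X *ℤ + k +ℤ V *ℤ + j))
      ≈ Q (X *ℤ + k) * pow (U V) k * f n
    expansion₃ {f} sol k X Y .(Y -ℤ X) n P.refl = begin
      sumTo k _
        ≈⟨ sumTo-cong k summand ⟩
      binomialSum (- U X) (U Y) (λ j → f (n′ +ℤ (Y -ℤ X) *ℤ + j)) k
        ≈⟨ binomialTransfer f (Q X * U (Y -ℤ X)) (- U X) (U Y) (-ℤ X) (Y -ℤ X) shift k n′ ⟩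
      pow (Q X * U (Y -ℤ X)) k * f (n′ +ℤ (-ℤ X) *ℤ + k)
        ≈⟨ *-cong (trans (pow-distrib _ _ k) (*-congʳ (sym (Q-* X k))))
                  (reflexive (P.cong f (restore n X (+ k)))) ⟩
      Q (X *ℤ + k) * pow (U (Y -ℤ X)) k * f n ∎
      where
      restore : ∀ n X K → (n +ℤ X *ℤ K) +ℤ (-ℤ X) *ℤ K ≡ n
      restore = solve-∀
      back : ∀ t X → (t +ℤ -ℤ X) +ℤ X ≡ t
      back = solve-∀
      across : ∀ t X Y → (t +ℤ -ℤ X) +ℤ Y ≡ t +ℤ (Y -ℤ X)
      across = solve-∀
      n′ : ℤ
      n′ = n +ℤ X *ℤ + k
      shift : ∀ t → (Q X * U (Y -ℤ X)) * f (t +ℤ -ℤ X) ≈ (- U X) * f (t +ℤ (Y -ℤ X)) + U Y * f t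
      shift t = begin
        (Q X * U (Y -ℤ X)) * f (t +ℤ -ℤ X)
          ≈⟨ index-reduction sol (t +ℤ -ℤ X) X Y ⟨
        U Y * f ((t +ℤ -ℤ X) +ℤ X) - U X * f ((t +ℤ -ℤ X) +ℤ Y)
          ≈⟨ reflexive (P.cong₂ (λ i j → U Y * f i - U X * f j) (back t X) (across t X Y)) ⟩
        U Y * f t - U X * f (t +ℤ (Y -ℤ X))
          ≈⟨ solve 4 (λ uy ft ux fv → uy :* ft :- ux :* fv := (:- ux) :* fv :+ uy :* ft)
                     refl (U Y) (f t) (U X) (f (t +ℤ (Y -ℤ X))) ⟩
        (- U X) * f (t +ℤ (Y -ℤ X)) + U Y * f t ∎
      summand : ∀ j → sgn j * nmul (k C j) 1# * pow (U X) j * pow (U Y) (k ∸ j)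
                      * f (n′ +ℤ (Y -ℤ X) *ℤ + j)
                    ≈ nmul (k C j) 1# * pow (- U X) j * pow (U Y) (k ∸ j)
                      * f (n′ +ℤ (Y -ℤ X) *ℤ + j)
      summand j = begin
        sgn j * cf * pow (U X) j * pow (U Y) (k ∸ j) * fj
          ≈⟨ solve 5 (λ s c a b w → s :* c :* a :* b :* w := c :* (s :* a) :* b :* w)
                     refl (sgn j) cf (pow (U X) j) (pow (U Y) (k ∸ j)) fj ⟩
        cf * (sgn j * pow (U X) j) * pow (U Y) (k ∸ j) * fj
          ≈⟨ *-congʳ (*-congʳ (*-congˡ (sym (pow-neg _ j)))) ⟩
        cf * pow (- U X) j * pow (U Y) (k ∸ j) * fj ∎
        where
        cf fj : Carrier
        cf = nmul (k C j) 1#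
        fj = f (n′ +ℤ (Y -ℤ X) *ℤ + j)

mainTheorem4 : {c ℓ : Level} (R : CommutativeRing c ℓ) →
    let open CommutativeRing R
        open Horadam R
    in (p q qi a b : Carrier) → ¬ (p ≈ 0#) → ¬ (q ≈ 0#) → q * qi ≈ 1# →
       (k : ℕ) → 1 ≤ k → (r s n m : ℤ) →
       let U = u p q qi
           W = w a b p q qi
           Q = zpow q qi
           K = + k
       in (sumTo k (λ j → sgn j * Q ((r -ℤ s) *ℤ (+ (k Data.Nat.∸ j))) * nmul (k C j) 1#
              * pow (U (m -ℤ s)) j * pow (U (m -ℤ r)) (k Data.Nat.∸ j)
              * W (n -ℤ (m -ℤ s) *ℤ K +ℤ (r -ℤ s) *ℤ (+ j)))
            ≈ sgn k * pow (U (r -ℤ s)) k * W n)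
        × (sumTo k (λ j → Q ((s -ℤ r) *ℤ (+ j)) * nmul (k C j) 1#
              * pow (U (r -ℤ s)) j * pow (U (m -ℤ r)) (k Data.Nat.∸ j)
              * W (n -ℤ (r -ℤ s) *ℤ K +ℤ (m -ℤ s) *ℤ (+ j)))
            ≈ Q ((s -ℤ r) *ℤ K) * pow (U (m -ℤ s)) k * W n)
        × (sumTo k (λ j → sgn j * nmul (k C j) 1#
              * pow (U (r -ℤ s)) j * pow (U (m -ℤ s)) (k Data.Nat.∸ j)
              * W (n +ℤ (r -ℤ s) *ℤ K +ℤ (m -ℤ r) *ℤ (+ j)))
            ≈ Q ((r -ℤ s) *ℤ K) * pow (U (m -ℤ r)) k * W n)
        × (sumTo k (λ j → sgn j * Q ((r -ℤ s) *ℤ (+ (k Data.Nat.∸ j))) * nmul (k C j) 1#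
              * pow (U (m +ℤ r)) j * pow (U (m +ℤ s)) (k Data.Nat.∸ j)
              * W (n -ℤ (m +ℤ r) *ℤ K +ℤ (r -ℤ s) *ℤ (+ j)))
            ≈ sgn k * pow (U (r -ℤ s)) k * W n)
        × (sumTo k (λ j → Q ((s -ℤ r) *ℤ (+ j)) * nmul (k C j) 1#
              * pow (U (r -ℤ s)) j * pow (U (m +ℤ s)) (k Data.Nat.∸ j)
              * W (n -ℤ (r -ℤ s) *ℤ K +ℤ (m +ℤ r) *ℤ (+ j)))
            ≈ Q ((s -ℤ r) *ℤ K) * pow (U (m +ℤ r)) k * W n)
        × (sumTo k (λ j → sgn j * nmul (k C j) 1#
              * pow (U (r -ℤ s)) j * pow (U (m +ℤ r)) (k Data.Nat.∸ j)
              * W (n +ℤ (r -ℤ s) *ℤ K +ℤ (m +ℤ s) *ℤ (+ j)))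
            ≈ Q ((r -ℤ s) *ℤ K) * pow (U (m +ℤ s)) k * W n)
mainTheorem4 R p q qi a b _ _ q*qi≈1 k _ r s n m =
    expansion₁ W-sol k (r -ℤ s) (m -ℤ s) (m -ℤ r) n (diff-minus m r s)
  , expansion₂ W-sol k (r -ℤ s) (s -ℤ r) (m -ℤ s) (m -ℤ r) n (opposite r s) (diff-minus m r s)
  , expansion₃ W-sol k (r -ℤ s) (m -ℤ s) (m -ℤ r) n (diff-minus m r s)
  , expansion₁ W-sol k (r -ℤ s) (m +ℤ r) (m +ℤ s) n (diff-plus m r s)
  , expansion₂ W-sol k (r -ℤ s) (s -ℤ r) (m +ℤ r) (m +ℤ s) n (opposite r s) (diff-plus m r s)
  , expansion₃ W-sol k (r -ℤ s) (m +ℤ r) (m +ℤ s) n (diff-plus m r s)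
  where
  open RingFacts R
  open Recurrence p q qi q*qi≈1
  W-sol : IsSolution (Horadam.w R a b p q qi)
  W-sol = w-isSolution a b
  -- In every case X = r − s; the side conditions identify the third index
  -- of U with Y − X and s − r with −X.
  diff-minus : ∀ m r s → m -ℤ r ≡ (m -ℤ s) -ℤ (r -ℤ s)
  diff-minus = solve-∀
  diff-plus : ∀ m r s → m +ℤ s ≡ (m +ℤ r) -ℤ (r -ℤ s)
  diff-plus = solve-∀
  opposite : ∀ r s → (s -ℤ r) +ℤ (r -ℤ s) ≡ + 0
  opposite = solve-∀
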